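{- Let $\mathbf A$ be a residuated ortholattice, and define ${\sim}x:=x\backslash 0$, $\overline{x}:={\sim}{\sim}x$, $x*y:=x\wedge({\sim}x\vee y)$, and $\overline{A}:=\{\overline{x}:x\in A\}$, ${\sim}A:=\{{\sim}x:x\in A\}$, $\overline{\overline A}:=\{\overline{\overline x}:x\in A\}$. Then ${\sim}$ is antitone, and for all $x,y\in A$: (1) ${\sim}1=0$ and ${\sim}0=1$; (2) $x\le{\sim}{\sim}x$; (3) ${\sim}x={\sim}{\sim}{\sim}x$; hence ${\sim}A\subseteq\overline A$ and $\overline A=\overline{\overline A}$; (4) ${\sim}(x\vee y)={\sim}x\wedge{\sim}y$; (5) ${\sim}{\sim}x={\sim}\neg x$; (6) if $x,y\in\overline A$ and $x\le y$, then $y*x=x$; (7) ${\sim}x\vee{\sim}y={\sim}(x\wedge y)$.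
   Context: A residuated ortholattice is an algebra $(A,\wedge,\vee,\neg,\backslash,0,1)$ where $(A,\wedge,\vee,0,1)$ is a bounded lattice, $\neg$ is an order-reversing involution, and $x\cdot y\le z\iff y\le x\backslash z$ for all $x,y,z$, where $x\cdot y:=x\wedge(\neg x\vee y)$ is the Sasaki product. -}

module Defs where

open import Level using (Level; suc)
open import Data.Product using (_×_; ∃)
open import Relation.Binary.PropositionalEquality using (_≡_)
open import Algebra.Lattice.Structures using (IsLattice)

record ResiduatedOrtholattice (c : Level) : Set (suc c) where
  infixr 7 _∧_
  infixr 6 _∨_
  infix  4 _≤_
  field
    Carrier : Set c
    _∧_ _∨_ : Carrier → Carrier → Carrier
    ¬_      : Carrier → Carrier
    _\\_    : Carrier → Carrier → Carrier
    𝟘 𝟙     : Carrier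
    isLattice : IsLattice _≡_ _∨_ _∧_

  _≤_ : Carrier → Carrier → Set c
  x ≤ y = x ∧ y ≡ x

  _·_ : Carrier → Carrier → Carrier
  x · y = x ∧ (¬ x ∨ y)

  field
    𝟘-least    : ∀ x → 𝟘 ≤ x
    𝟙-greatest : ∀ x → x ≤ 𝟙
    ¬-involutive : ∀ x → ¬ (¬ x) ≡ x
    ¬-antitone   : ∀ {x y} → x ≤ y → ¬ y ≤ ¬ x
    residuation₁ : ∀ x y z → x · y ≤ z → y ≤ x \\ z
    residuation₂ : ∀ x y z → y ≤ x \\ z → x · y ≤ z

  ∼_ : Carrier → Carrier
  ∼ x = x \\ 𝟘

  bar : Carrier → Carrier
  bar x = ∼ (∼ x)

  _*_ : Carrier → Carrier → Carrier
  x * y = x ∧ (∼ x ∨ y)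

  _∈Ā : Carrier → Set c
  x ∈Ā = ∃ λ u → x ≡ bar u

  _∈∼A : Carrier → Set c
  x ∈∼A = ∃ λ u → x ≡ ∼ u

  _∈Ā̄ : Carrier → Set c
  x ∈Ā̄ = ∃ λ u → x ≡ bar (bar u)

{-# OPTIONS --safe #-}
-- Residuation makes x · _ join-preserving, and x · 𝟘 ≤ 𝟘 forces x ∧ ¬ x = 𝟘 and
-- x ∨ ¬ x = 𝟙, hence the splitting x ≤ x · a ∨ x · ¬ a.  The central fact is that
-- orthogonality x · y ≤ 𝟘 is symmetric, i.e. ∼ is an antitone Galois connection with
-- itself; (1)–(4) are formal consequences.  For (6) and (7) one splits an element c
-- along some a and uses that the Sasaki projection c · u of u ≤ c is orthogonal to
-- ¬ u, so c · u ≤ ∼ ∼ u.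
module Submission where

open import Defs
open import Level using (Level)
open import Data.Product using (_×_; _,_)
open import Function using (_∘_)
open import Relation.Binary.PropositionalEquality
  using (_≡_; refl; sym; cong; cong₂; isEquivalence)
import Algebra.Lattice.Bundles as Alg
import Algebra.Lattice.Properties.Lattice as AlgLatticeProperties
import Relation.Binary.Lattice as Ord
import Relation.Binary.Lattice.Properties.JoinSemilattice as JoinSemilatticeProperties
import Relation.Binary.Lattice.Properties.MeetSemilattice as MeetSemilatticeProperties
import Relation.Binary.Reasoning.PartialOrder as ≤-Reasoning

module ResiduatedOrtholatticeProperties {c : Level} (A : ResiduatedOrtholattice c) where

  open ResiduatedOrtholattice A

  -- The library orders a lattice by x ≡ x ∧ y, the converse equation of x ≤ y here.
  orderLattice : Ord.Lattice c c c
  orderLattice = record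
    { isLattice = record
      { isPartialOrder = record
        { isPreorder = record
          { isEquivalence = isEquivalence
          ; reflexive     = sym ∘ L.reflexive
          ; trans         = λ p q → sym (L.trans (sym p) (sym q))
          }
        ; antisym = λ p q → L.antisym (sym p) (sym q)
        }
      ; supremum = λ x y →
          sym (L.x≤x∨y x y) , sym (L.y≤x∨y x y) , λ _ p q → sym (L.∨-least (sym p) (sym q))
      ; infimum = λ x y →
          sym (L.x∧y≤x x y) , sym (L.x∧y≤y x y) , λ _ p q → sym (L.∧-greatest (sym p) (sym q))
      }
    }
    where
    algebraicLattice : Alg.Lattice c c
    algebraicLattice = record { isLattice = isLattice }
    module L = Ord.Lattice (AlgLatticeProperties.∨-∧-orderTheoreticLattice algebraicLattice)

  open Ord.Lattice orderLattice public
    using (poset; x≤x∨y; y≤x∨y; ∨-least; x∧y≤x; x∧y≤y; ∧-greatest)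
    renaming (refl to ≤-refl; reflexive to ≤-reflexive; trans to ≤-trans; antisym to ≤-antisym)
  open JoinSemilatticeProperties (Ord.Lattice.joinSemilattice orderLattice) using (∨-monotonic)
  open MeetSemilatticeProperties (Ord.Lattice.meetSemilattice orderLattice) using (∧-monotonic)
  open ≤-Reasoning poset

  x≤¬y⇒y≤¬x : ∀ {x y} → x ≤ ¬ y → y ≤ ¬ x
  x≤¬y⇒y≤¬x {x} {y} p = begin
    y      ≡⟨ sym (¬-involutive y) ⟩
    ¬ ¬ y  ≤⟨ ¬-antitone p ⟩
    ¬ x    ∎

  ¬x≤y⇒¬y≤x : ∀ {x y} → ¬ x ≤ y → ¬ y ≤ x
  ¬x≤y⇒¬y≤x {x} {y} p = begin
    ¬ y    ≤⟨ ¬-antitone p ⟩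
    ¬ ¬ x  ≡⟨ ¬-involutive x ⟩
    x      ∎

  x·y≤x : ∀ {x y} → x · y ≤ x
  x·y≤x = x∧y≤x _ _

  x·y≤¬x∨y : ∀ {x y} → x · y ≤ ¬ x ∨ y
  x·y≤¬x∨y = x∧y≤y _ _

  x∧y≤x·y : ∀ {x y} → x ∧ y ≤ x · y
  x∧y≤x·y = ∧-monotonic ≤-refl (y≤x∨y _ _)

  ¬x≤y⇒x·y≤x∧y : ∀ {x y} → ¬ x ≤ y → x · y ≤ x ∧ y
  ¬x≤y⇒x·y≤x∧y p = ∧-monotonic ≤-refl (∨-least p ≤-refl)

  ·-distribˡ-∨ : ∀ {x y z} → x · (y ∨ z) ≤ x · y ∨ x · z
  ·-distribˡ-∨ {x} {y} {z} = residuation₂ x (y ∨ z) _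
    (∨-least (residuation₁ x y _ (x≤x∨y _ _)) (residuation₁ x z _ (y≤x∨y _ _)))

  x∧¬x≤𝟘 : ∀ {x} → x ∧ ¬ x ≤ 𝟘
  x∧¬x≤𝟘 {x} = begin
    x ∧ ¬ x  ≤⟨ ∧-monotonic ≤-refl (x≤x∨y _ _) ⟩
    x · 𝟘    ≤⟨ residuation₂ x 𝟘 𝟘 (𝟘-least _) ⟩
    𝟘        ∎

  𝟙≤x∨¬x : ∀ {x} → 𝟙 ≤ x ∨ ¬ x
  𝟙≤x∨¬x {x} = begin
    𝟙        ≡⟨ sym (¬-involutive 𝟙) ⟩
    ¬ ¬ 𝟙    ≤⟨ ¬x≤y⇒¬y≤x (≤-trans ¬[x∨¬x]≤𝟘 (𝟘-least _)) ⟩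
    x ∨ ¬ x  ∎
    where
    ¬[x∨¬x]≤𝟘 : ¬ (x ∨ ¬ x) ≤ 𝟘
    ¬[x∨¬x]≤𝟘 = ≤-trans
      (∧-greatest (¬x≤y⇒¬y≤x (y≤x∨y x (¬ x))) (¬-antitone (x≤x∨y x (¬ x)))) x∧¬x≤𝟘

  x≤x·a∨x·¬a : ∀ {x a} → x ≤ x · a ∨ x · (¬ a)
  x≤x·a∨x·¬a {x} {a} = begin
    x                  ≤⟨ ∧-greatest ≤-refl (≤-trans (𝟙-greatest x) (≤-trans 𝟙≤x∨¬x (y≤x∨y _ _))) ⟩
    x · (a ∨ ¬ a)      ≤⟨ ·-distribˡ-∨ ⟩
    x · a ∨ x · (¬ a)  ∎

  ¬u∧c·u≤𝟘 : ∀ {c u} → ¬ u ∧ (c · u) ≤ 𝟘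
  ¬u∧c·u≤𝟘 {c} {u} = ≤-trans (∧-greatest ≤w ≤¬w) x∧¬x≤𝟘
    where
    w = c ∧ ¬ u
    ≤w : ¬ u ∧ (c · u) ≤ w
    ≤w = ∧-greatest (≤-trans (x∧y≤y _ _) x·y≤x) (x∧y≤x _ _)
    ≤¬w : ¬ u ∧ (c · u) ≤ ¬ w
    ≤¬w = ≤-trans (x∧y≤y _ _) (≤-trans x·y≤¬x∨y
      (∨-least (¬-antitone (x∧y≤x _ _)) (x≤¬y⇒y≤¬x (x∧y≤y _ _))))

  ¬x≤∼x : ∀ {x} → ¬ x ≤ ∼ x
  ¬x≤∼x {x} = residuation₁ x (¬ x) 𝟘 (≤-trans (¬x≤y⇒x·y≤x∧y ≤-refl) x∧¬x≤𝟘)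

  x∧∼x≤𝟘 : ∀ {x} → x ∧ ∼ x ≤ 𝟘
  x∧∼x≤𝟘 {x} = ≤-trans x∧y≤x·y (residuation₂ x (∼ x) 𝟘 ≤-refl)

  -- y · x lies below both y and ¬ y.
  y≤∼x⇒x≤∼y : ∀ {x y} → y ≤ ∼ x → x ≤ ∼ y
  y≤∼x⇒x≤∼y {x} {y} y≤∼x = residuation₁ y x 𝟘 (≤-trans (∧-greatest x·y≤x y·x≤¬y) x∧¬x≤𝟘)
    where
    a = ¬ x ∨ y
    a·x≤𝟘 : a · x ≤ 𝟘
    a·x≤𝟘 = begin
      a · x  ≤⟨ ¬x≤y⇒x·y≤x∧y (¬x≤y⇒¬y≤x (x≤x∨y _ _)) ⟩
      a ∧ x  ≤⟨ ∧-greatest (x∧y≤y _ _) (x∧y≤x _ _) ⟩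
      x · y  ≤⟨ residuation₂ x y 𝟘 y≤∼x ⟩
      𝟘      ∎
    y·x≤¬y : y · x ≤ ¬ y
    y·x≤¬y = begin
      y · x                ≤⟨ ∧-monotonic (y≤x∨y _ _) (∨-least (≤-trans (y≤x∨y x _) (y≤x∨y _ _))
                                                                (≤-trans (x≤x∨y x _) (y≤x∨y _ _))) ⟩
      a · (x ∨ ¬ y)        ≤⟨ ·-distribˡ-∨ ⟩
      a · x ∨ a · (¬ y)    ≤⟨ ∨-monotonic a·x≤𝟘 x·y≤¬x∨y ⟩
      𝟘 ∨ (¬ a ∨ ¬ y)      ≤⟨ ∨-least (𝟘-least _) (∨-least (¬-antitone (y≤x∨y _ _)) ≤-refl) ⟩
      ¬ y                  ∎

  x≤∼∼x : ∀ {x} → x ≤ ∼ (∼ x)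
  x≤∼∼x = y≤∼x⇒x≤∼y ≤-refl

  ∼-antitone : ∀ {x y} → x ≤ y → ∼ y ≤ ∼ x
  ∼-antitone x≤y = y≤∼x⇒x≤∼y (≤-trans x≤y x≤∼∼x)

  ∼∼∼x≡∼x : ∀ {x} → ∼ (∼ (∼ x)) ≡ ∼ x
  ∼∼∼x≡∼x = ≤-antisym (∼-antitone x≤∼∼x) x≤∼∼x

  ∼𝟙≡𝟘 : ∼ 𝟙 ≡ 𝟘
  ∼𝟙≡𝟘 = ≤-antisym (≤-trans (∧-greatest (𝟙-greatest _) ≤-refl) x∧∼x≤𝟘) (𝟘-least _)

  ∼𝟘≡𝟙 : ∼ 𝟘 ≡ 𝟙
  ∼𝟘≡𝟙 = ≤-antisym (𝟙-greatest _) (residuation₁ 𝟘 𝟙 𝟘 x·y≤x)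

  ∼-∨ : ∀ {x y} → ∼ (x ∨ y) ≡ ∼ x ∧ ∼ y
  ∼-∨ = ≤-antisym
    (∧-greatest (∼-antitone (x≤x∨y _ _)) (∼-antitone (y≤x∨y _ _)))
    (y≤∼x⇒x≤∼y (∨-least (y≤∼x⇒x≤∼y (x∧y≤x _ _)) (y≤∼x⇒x≤∼y (x∧y≤y _ _))))

  x≤∼¬x : ∀ {x} → x ≤ ∼ (¬ x)
  x≤∼¬x = y≤∼x⇒x≤∼y ¬x≤∼x

  -- ∼ x and ∼ ¬ x are orthogonal: their meet is ∼ (x ∨ ¬ x) = ∼ 𝟙 = 𝟘.
  ∼∼x≡∼¬x : ∀ {x} → ∼ (∼ x) ≡ ∼ (¬ x)
  ∼∼x≡∼¬x {x} = ≤-antisym (∼-antitone ¬x≤∼x) (residuation₁ (∼ x) (∼ (¬ x)) 𝟘 (begin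
    (∼ x) · (∼ (¬ x))  ≤⟨ ¬x≤y⇒x·y≤x∧y (≤-trans (¬x≤y⇒¬y≤x ¬x≤∼x) x≤∼¬x) ⟩
    ∼ x ∧ ∼ (¬ x)      ≡⟨ sym ∼-∨ ⟩
    ∼ (x ∨ ¬ x)        ≤⟨ ∼-antitone 𝟙≤x∨¬x ⟩
    ∼ 𝟙                ≡⟨ ∼𝟙≡𝟘 ⟩
    𝟘                  ∎))

  ∼∼¬x≡∼x : ∀ {x} → ∼ (∼ (¬ x)) ≡ ∼ x
  ∼∼¬x≡∼x {x} = begin-equality
    ∼ (∼ (¬ x))   ≡⟨ ∼∼x≡∼¬x ⟩
    ∼ (¬ ¬ x)     ≡⟨ cong ∼_ (¬-involutive x) ⟩
    ∼ x           ∎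

  u≤c⇒c·u≤∼∼u : ∀ {u c} → u ≤ c → c · u ≤ ∼ (∼ u)
  u≤c⇒c·u≤∼∼u {u} {c} u≤c = begin
    c · u        ≤⟨ residuation₁ (¬ u) (c · u) 𝟘 (≤-trans (¬x≤y⇒x·y≤x∧y ¬¬u≤c·u) ¬u∧c·u≤𝟘) ⟩
    ∼ (¬ u)      ≡⟨ sym ∼∼x≡∼¬x ⟩
    ∼ (∼ u)      ∎
    where
    ¬¬u≤c·u : ¬ ¬ u ≤ c · u
    ¬¬u≤c·u = begin
      ¬ ¬ u  ≡⟨ ¬-involutive u ⟩
      u      ≤⟨ ∧-greatest u≤c (y≤x∨y _ _) ⟩
      c · u  ∎

  ∼∼-∨ : ∀ {x y} → ∼ (∼ (x ∨ y)) ≤ ∼ (∼ x) ∨ ∼ (∼ y)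
  ∼∼-∨ {x} {y} = begin
    s̄                         ≤⟨ x≤x·a∨x·¬a ⟩
    s̄ · s ∨ s̄ · (¬ s)         ≤⟨ ∨-monotonic ·-distribˡ-∨ s̄·¬s≤𝟘 ⟩
    (s̄ · x ∨ s̄ · y) ∨ 𝟘       ≤⟨ ∨-least (∨-monotonic (u≤c⇒c·u≤∼∼u (≤s̄ (x≤x∨y x y)))
                                                       (u≤c⇒c·u≤∼∼u (≤s̄ (y≤x∨y x y))))
                                          (𝟘-least _) ⟩
    ∼ (∼ x) ∨ ∼ (∼ y)         ∎
    where
    s = x ∨ y
    s̄ = ∼ (∼ s)
    ≤s̄ : ∀ {u} → u ≤ s → u ≤ s̄
    ≤s̄ u≤s = ≤-trans u≤s x≤∼∼x
    s̄·¬s≤𝟘 : s̄ · (¬ s) ≤ 𝟘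
    s̄·¬s≤𝟘 = residuation₂ s̄ (¬ s) 𝟘 (≤-trans ¬x≤∼x (≤-reflexive (sym ∼∼∼x≡∼x)))

  ∼-∧ : ∀ {x y} → ∼ x ∨ ∼ y ≡ ∼ (x ∧ y)
  ∼-∧ {x} {y} = ≤-antisym (∨-least (∼-antitone (x∧y≤x _ _)) (∼-antitone (x∧y≤y _ _))) (begin
    ∼ (x ∧ y)                  ≤⟨ ∼-antitone (∧-greatest (¬x≤y⇒¬y≤x (x≤x∨y _ _))
                                                          (¬x≤y⇒¬y≤x (y≤x∨y _ _))) ⟩
    ∼ (¬ (¬ x ∨ ¬ y))          ≡⟨ sym ∼∼x≡∼¬x ⟩
    ∼ (∼ (¬ x ∨ ¬ y))          ≤⟨ ∼∼-∨ ⟩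
    ∼ (∼ (¬ x)) ∨ ∼ (∼ (¬ y))  ≡⟨ cong₂ _∨_ ∼∼¬x≡∼x ∼∼¬x≡∼x ⟩
    ∼ x ∨ ∼ y                  ∎)

  y*x∧¬x≤𝟘 : ∀ {x y} → (y * x) ∧ ¬ x ≤ 𝟘
  y*x∧¬x≤𝟘 {x} {y} = ≤-trans (∧-greatest ≤z ≤∼z) x∧∼x≤𝟘
    where
    z = y ∧ ∼ x
    ≤z : (y * x) ∧ ¬ x ≤ z
    ≤z = ∧-monotonic (x∧y≤x _ _) ¬x≤∼x
    ≤∼z : (y * x) ∧ ¬ x ≤ ∼ z
    ≤∼z = ≤-trans (x∧y≤x _ _) (≤-trans (x∧y≤y _ _)
      (∨-least (∼-antitone (x∧y≤x _ _)) (≤-trans x≤∼∼x (∼-antitone (x∧y≤y _ _)))))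

  ∼∼x≤x⇒x≤y⇒y*x≡x : ∀ {x y} → ∼ (∼ x) ≤ x → x ≤ y → y * x ≡ x
  ∼∼x≤x⇒x≤y⇒y*x≡x {x} {y} closed x≤y = ≤-antisym y*x≤x x≤y*x
    where
    x≤y*x : x ≤ y * x
    x≤y*x = ∧-greatest x≤y (y≤x∨y _ _)
    y*x≤x : y * x ≤ x
    y*x≤x = begin
      y * x                            ≤⟨ x≤x·a∨x·¬a ⟩
      (y * x) · x ∨ (y * x) · (¬ x)    ≤⟨ ∨-monotonic (u≤c⇒c·u≤∼∼u x≤y*x)
                                                      (¬x≤y⇒x·y≤x∧y (¬-antitone x≤y*x)) ⟩
      ∼ (∼ x) ∨ ((y * x) ∧ ¬ x)        ≤⟨ ∨-least closed (≤-trans y*x∧¬x≤𝟘 (𝟘-least _)) ⟩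
      x                                ∎

lemma4p2 : ∀ {c : Level} (A : ResiduatedOrtholattice c) →
    let open ResiduatedOrtholattice A in
      (∀ {x y} → x ≤ y → ∼ y ≤ ∼ x)
      × ((∼ 𝟙 ≡ 𝟘) × (∼ 𝟘 ≡ 𝟙))
      × (∀ x → x ≤ ∼ (∼ x))
      × ((∀ x → ∼ x ≡ ∼ (∼ (∼ x)))
         × (∀ x → x ∈∼A → x ∈Ā)
         × (∀ x → x ∈Ā → x ∈Ā̄)
         × (∀ x → x ∈Ā̄ → x ∈Ā))
      × (∀ x y → ∼ (x ∨ y) ≡ ∼ x ∧ ∼ y)
      × (∀ x → ∼ (∼ x) ≡ ∼ (¬ x))
      × (∀ x y → x ∈Ā → y ∈Ā → x ≤ y → y * x ≡ x)
      × (∀ x y → ∼ x ∨ ∼ y ≡ ∼ (x ∧ y))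
lemma4p2 A =
    ∼-antitone
  , (∼𝟙≡𝟘 , ∼𝟘≡𝟙)
  , (λ _ → x≤∼∼x)
  , ( (λ _ → sym ∼∼∼x≡∼x)
    , (λ { _ (u , refl) → ∼ u , sym ∼∼∼x≡∼x })
    , (λ { _ (u , refl) → u , cong ∼_ (sym ∼∼∼x≡∼x) })
    , (λ { _ (u , refl) → bar u , refl }))
  , (λ _ _ → ∼-∨)
  , (λ _ → ∼∼x≡∼¬x)
  , (λ { _ _ (u , refl) _ → ∼∼x≤x⇒x≤y⇒y*x≡x (≤-reflexive ∼∼∼x≡∼x) })
  , (λ _ _ → ∼-∧)
  where
  open ResiduatedOrtholattice A using (∼_; bar)
  open ResiduatedOrtholatticeProperties A
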